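{- Let $G=(V,E)$ be a graph with maximum degree $\Delta(G)\ge 1$ and let $X\subseteq V$. Then \[\left\lceil\frac{Z(G;X)}{\Delta(G)}\right\rceil\le \gamma_P(G;X),\] and this bound is tight, i.e., there exist a graph $G$ with $\Delta(G)\ge 1$ and a set $X\subseteq V(G)$ for which equality holds.
   Context: All graphs are finite, simple and undirected. $N(v)$ denotes the set of neighbors of $v$, $N[v]=N(v)\cup\{v\}$, and $N[S]=\bigcup_{v\in S}N[v]$ for $S\subseteq V$. For $S\subseteq V$, the set $PD(S)$ is defined by: initially $PD(S)=N[S]$; while there exists $v\in PD(S)$ with $|N(v)\setminus PD(S)|=1$, replace $PD(S)$ by $PD(S)\cup N(v)$. $S$ is a power dominating set of $G$ if at the end $PD(S)=V$. For $X\subseteq V$, $\gamma_P(G;X)$ is the minimum cardinality of a power dominating set of $G$ containing $X$. Zero forcing: given a set $B$ of blue vertices (others white), the color change rule says that if a blue vertex $u$ has exactly one white neighbor $w$, then $w$ is colored blue. The closure $cl(B)$ is the set of blue vertices after applying this rule until no more changes are possible; $B$ is a zero forcing set if $cl(B)=V$. $Z(G;X)$ is the minimum cardinality of a zero forcing set of $G$ containing $X$. $\Delta(G)$ is the maximum degree of $G$. -}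

module Defs where

open import Data.Nat using (ℕ; zero; suc; _+_; _≤_; _⊔_)
open import Data.Nat.DivMod using (_/_)
open import Data.Bool using (Bool; true; false; _∧_; _∨_)
open import Data.Fin using (Fin; _≟_)
open import Data.Fin.Subset using (Subset; _⊆_; ∣_∣; ⊤)
open import Data.Vec using (lookup; tabulate; _[_]≔_)
open import Data.List using (foldr; map; allFin)
open import Data.Product using (Σ; ∃; _×_)
open import Relation.Binary.PropositionalEquality using (_≡_)
open import Relation.Binary.Construct.Closure.ReflexiveTransitive using (Star)
open import Relation.Nullary.Decidable using (⌊_⌋)

record Graph : Set where
  field
    n      : ℕ
    adj    : Fin n → Fin n → Bool
    sym    : ∀ u v → adj u v ≡ adj v u
    irrefl : ∀ v → adj v v ≡ false
open Graph public

V : Graph → Set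
V G = Fin (n G)

VSet : Graph → Set
VSet G = Subset (n G)

anyFin : ∀ {m} → (Fin m → Bool) → Bool
anyFin {m} p = foldr _∨_ false (map p (allFin m))

deg : (G : Graph) → V G → ℕ
deg G v = ∣ tabulate (adj G v) ∣

Δ : Graph → ℕ
Δ G = foldr _⊔_ 0 (map (deg G) (allFin (n G)))

N[_]_ : (G : Graph) → VSet G → VSet G
N[ G ] S = tabulate λ v → anyFin λ u → lookup S u ∧ (adj G u v ∨ ⌊ u ≟ v ⌋)

-- One application of the (zero forcing / power propagation) colour change rule:
-- a vertex u in B with exactly one neighbour w outside B adds w to B.
Force : (G : Graph) → VSet G → VSet G → Set
Force G B B' =
  Σ (V G) λ u → Σ (V G) λ w →
    (lookup B u ≡ true) × (adj G u w ≡ true) × (lookup B w ≡ false) ×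
    (∀ x → adj G u x ≡ true → lookup B x ≡ false → x ≡ w) ×
    (B' ≡ B [ w ]≔ true)

Propagates : (G : Graph) → VSet G → VSet G → Set
Propagates G = Star (Force G)

ClosureIsAll : (G : Graph) → VSet G → Set
ClosureIsAll G B = Propagates G B ⊤

IsZeroForcingSet : (G : Graph) → VSet G → Set
IsZeroForcingSet G B = ClosureIsAll G B

-- PD(S) starts at N[S] and grows by the same rule
IsPowerDominatingSet : (G : Graph) → VSet G → Set
IsPowerDominatingSet G S = ClosureIsAll G (N[ G ] S)

IsZ : (G : Graph) → VSet G → ℕ → Set
IsZ G X k =
  (Σ (VSet G) λ B → X ⊆ B × IsZeroForcingSet G B × ∣ B ∣ ≡ k) ×
  (∀ B → X ⊆ B → IsZeroForcingSet G B → k ≤ ∣ B ∣)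

IsγP : (G : Graph) → VSet G → ℕ → Set
IsγP G X k =
  (Σ (VSet G) λ S → X ⊆ S × IsPowerDominatingSet G S × ∣ S ∣ ≡ k) ×
  (∀ S → X ⊆ S → IsPowerDominatingSet G S → k ≤ ∣ S ∣)

-- ⌈ a / d ⌉ (only used with d ≥ 1)
⌈_/_⌉ : ℕ → ℕ → ℕ
⌈ a / zero ⌉ = 0
⌈ a / suc d ⌉ = (a + d) / suc d

-- Given a power dominating set S, precolour, for every v ∈ S, all neighbours of v except one,
-- w_v.  Then every v ∈ S is blue with at most w_v among its neighbours white, and this persists
-- as colours spread, so the vertices of S force their w_v one after another: the precoloured set
-- propagates to N[S] and from there, S being power dominating, to all of V.  Each v adds at most
-- Δ - 1 vertices, so Z(G;X) ≤ Δ·γP(G;X).  Equality holds for K₂ with X = V.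
module Submission where

open import Defs hiding (sym)
open import Data.Bool using (true; false; T; not; _∧_; _∨_)
open import Data.Bool.Properties using (∨-zeroʳ; ∨-identityʳ; T-≡; T-∧; T-∨)
open import Data.Fin using (Fin; _≟_) renaming (zero to fz; suc to fs)
open import Data.Fin.Subset
  using (Subset; inside; outside; ⊤; ⊥; _∈_; _∉_; _⊆_; ∣_∣; _∪_; ⁅_⁆; _-_; ⋃)
open import Data.Fin.Subset.Properties
  using (_∈?_; ⊆-refl; ⊆-antisym; ⊆⊤; ⊥⊆; p⊆p∪q; q⊆p∪q; x∈p∪q⁻; x∈p∪q⁺; ∪-identityʳ; ∪-assoc;
         x∈⁅x⁆; x∈⁅y⁆⇒x≡y; x∈p∧x≢y⇒x∈p-y; p─q⊆p; nonempty?; Empty-unique;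
         ∣⊥∣≡0; ∣⊤∣≡n; p⊆q⇒∣p∣≤∣q∣; ∣p─q∣≤∣p∣; x∈p⇒∣p-x∣<∣p∣)
open import Data.List using (List; []; _∷_; length; map; foldr; allFin)
open import Data.List.Properties using (length-map)
open import Data.List.Membership.Propositional using () renaming (_∈_ to _∈ˡ_)
open import Data.List.Membership.Propositional.Properties using (∈-map⁺; ∈-map⁻; ∈-allFin)
open import Data.List.Relation.Unary.Any as Any using (here; there)
open import Data.List.Relation.Unary.Any.Properties using (any⁺; any⁻)
open import Data.Nat using (ℕ; suc; _+_; _*_; _⊔_; _≤_; z≤n; s≤s)
open import Data.Nat.Properties
  using (≤-trans; ≤-reflexive; ≤-pred; n≤1+n; n<1+n; m≤m⊔n; m≤n⊔m; +-suc; *-suc; +-identityʳ;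
         +-mono-≤; +-monoˡ-≤; +-monoʳ-≤; module ≤-Reasoning)
open import Data.Nat.DivMod using (_/_; +-distrib-/-∣ˡ; /-monoˡ-≤; m*n/n≡m; m<n⇒m/n≡0)
open import Data.Nat.Divisibility using (n∣m*n)
open import Data.Product using (Σ; ∃-syntax; _×_; _,_; proj₁; proj₂)
open import Data.Sum as Sum using (_⊎_; inj₁; inj₂; [_,_]′)
open import Data.Vec using ([]; _∷_; here; there; _[_]≔_; lookup; tabulate)
open import Data.Vec.Properties using (lookup∘tabulate; lookup⇒[]=; []=⇒lookup)
open import Function using (_∘_; case_of_)
open import Function.Bundles using (Equivalence)
open import Relation.Binary.Construct.Closure.ReflexiveTransitive using (ε; _◅_; _◅◅_)
open import Relation.Binary.PropositionalEquality using (_≡_; refl; sym; cong; cong₂; trans; subst)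
open import Relation.Nullary using (yes; no; contradiction)
open import Relation.Nullary.Decidable using (⌊_⌋; toWitness; fromWitness)

private
  variable
    m d : ℕ
    p q r : Subset m
    x : Fin m

∪-least : p ⊆ r → q ⊆ r → p ∪ q ⊆ r
∪-least {p = p} {q = q} p⊆r q⊆r x∈p∪q = [ p⊆r , q⊆r ]′ (x∈p∪q⁻ p q x∈p∪q)

p⊆q⇒q∪p≡q : p ⊆ q → q ∪ p ≡ q
p⊆q⇒q∪p≡q p⊆q = ⊆-antisym (∪-least (λ x∈q → x∈q) p⊆q) (p⊆p∪q _)

⁅⁆⊆ : x ∈ p → ⁅ x ⁆ ⊆ p
⁅⁆⊆ {x = x} x∈p y∈⁅x⁆ rewrite x∈⁅y⁆⇒x≡y x y∈⁅x⁆ = x∈p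

⊆-∪⁅⁆-absorb : (x ∈ p → x ∈ q) → p ⊆ q ∪ ⁅ x ⁆ → p ⊆ q
⊆-∪⁅⁆-absorb {x = x} {q = q} x∈p⇒x∈q p⊆q∪x y∈p with x∈p∪q⁻ q ⁅ x ⁆ (p⊆q∪x y∈p)
... | inj₁ y∈q = y∈q
... | inj₂ y∈x rewrite x∈⁅y⁆⇒x≡y x y∈x = x∈p⇒x∈q y∈p

∪-monoˡ-⊆ : p ⊆ q → p ∪ r ⊆ q ∪ r
∪-monoˡ-⊆ {q = q} p⊆q = ∪-least (p⊆p∪q _ ∘ p⊆q) (q⊆p∪q q _)

p⊆p-x∪⁅x⁆ : (p : Subset m) (x : Fin m) → p ⊆ (p - x) ∪ ⁅ x ⁆
p⊆p-x∪⁅x⁆ p x {y} y∈p with y ≟ x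
... | yes refl = x∈p∪q⁺ (inj₂ (x∈⁅x⁆ x))
... | no  y≢x  = x∈p∪q⁺ (inj₁ (x∈p∧x≢y⇒x∈p-y y∈p y≢x))

[]≔inside≡∪⁅⁆ : (p : Subset m) (x : Fin m) → p [ x ]≔ inside ≡ p ∪ ⁅ x ⁆
[]≔inside≡∪⁅⁆ (b ∷ p) fz     = cong₂ _∷_ (sym (∨-zeroʳ b)) (sym (∪-identityʳ p))
[]≔inside≡∪⁅⁆ (b ∷ p) (fs x) = cong₂ _∷_ (sym (∨-identityʳ b)) ([]≔inside≡∪⁅⁆ p x)

∉⇒lookup≡false : x ∉ p → lookup p x ≡ false
∉⇒lookup≡false {x = x} {p = p} x∉p with lookup p x in eq
... | false = refl
... | true  = contradiction (lookup⇒[]= x p eq) x∉p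

∣p∪q∣≤∣p∣+∣q∣ : (p q : Subset m) → ∣ p ∪ q ∣ ≤ ∣ p ∣ + ∣ q ∣
∣p∪q∣≤∣p∣+∣q∣ []            []            = z≤n
∣p∪q∣≤∣p∣+∣q∣ (inside  ∷ p) (inside  ∷ q) = s≤s (≤-trans (∣p∪q∣≤∣p∣+∣q∣ p q) (+-monoʳ-≤ ∣ p ∣ (n≤1+n ∣ q ∣)))
∣p∪q∣≤∣p∣+∣q∣ (inside  ∷ p) (outside ∷ q) = s≤s (∣p∪q∣≤∣p∣+∣q∣ p q)
∣p∪q∣≤∣p∣+∣q∣ (outside ∷ p) (inside  ∷ q) = ≤-trans (s≤s (∣p∪q∣≤∣p∣+∣q∣ p q)) (≤-reflexive (sym (+-suc ∣ p ∣ ∣ q ∣)))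
∣p∪q∣≤∣p∣+∣q∣ (outside ∷ p) (outside ∷ q) = ∣p∪q∣≤∣p∣+∣q∣ p q

module _ {A : Set} (f : A → Subset m) where

  ⊆-⋃-map : ∀ {a xs} → a ∈ˡ xs → f a ⊆ ⋃ (map f xs)
  ⊆-⋃-map {xs = a ∷ xs} (here refl) = p⊆p∪q (⋃ (map f xs))
  ⊆-⋃-map {xs = b ∷ xs} (there a∈xs) = q⊆p∪q (f b) _ ∘ ⊆-⋃-map a∈xs

  ⋃-map-least : ∀ {xs} → (∀ {a} → a ∈ˡ xs → f a ⊆ r) → ⋃ (map f xs) ⊆ r
  ⋃-map-least {xs = []}     _   = ⊥⊆
  ⋃-map-least {xs = a ∷ xs} f⊆r = ∪-least (f⊆r (here refl)) (⋃-map-least (f⊆r ∘ there))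

  ∣⋃-map∣≤ : (∀ a → ∣ f a ∣ ≤ d) → ∀ xs → ∣ ⋃ (map f xs) ∣ ≤ length xs * d
  ∣⋃-map∣≤ _ [] = ≤-reflexive (∣⊥∣≡0 m)
  ∣⋃-map∣≤ ∣f∣≤d (a ∷ xs) = ≤-trans (∣p∪q∣≤∣p∣+∣q∣ (f a) _) (+-mono-≤ (∣f∣≤d a) (∣⋃-map∣≤ ∣f∣≤d xs))

elements : Subset m → List (Fin m)
elements []            = []
elements (inside  ∷ p) = fz ∷ map fs (elements p)
elements (outside ∷ p) = map fs (elements p)

length-elements : (p : Subset m) → length (elements p) ≡ ∣ p ∣
length-elements []            = refl
length-elements (inside  ∷ p) = cong suc (trans (length-map fs (elements p)) (length-elements p))
length-elements (outside ∷ p) = trans (length-map fs (elements p)) (length-elements p)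

∈-elements⁺ : x ∈ p → x ∈ˡ elements p
∈-elements⁺ here = here refl
∈-elements⁺ {p = inside  ∷ p} (there x∈p) = there (∈-map⁺ fs (∈-elements⁺ x∈p))
∈-elements⁺ {p = outside ∷ p} (there x∈p) = ∈-map⁺ fs (∈-elements⁺ x∈p)

∈-elements⁻ : (p : Subset m) → x ∈ˡ elements p → x ∈ p
∈-elements⁻ (inside ∷ p) (here refl) = here
∈-elements⁻ (inside ∷ p) (there x∈) with ∈-map⁻ fs x∈
... | y , y∈ , refl = there (∈-elements⁻ p y∈)
∈-elements⁻ (outside ∷ p) x∈ with ∈-map⁻ fs x∈
... | y , y∈ , refl = there (∈-elements⁻ p y∈)

-- The Fin m argument is the element removed when p is empty.
∣p∣≤1+d⇒∃∣p-x∣≤d : (p : Subset m) → Fin m → ∣ p ∣ ≤ suc d → ∃[ x ] ∣ p - x ∣ ≤ d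
∣p∣≤1+d⇒∃∣p-x∣≤d {m = m} p y ∣p∣≤1+d with nonempty? p
... | yes (x , x∈p) = x , ≤-pred (≤-trans (x∈p⇒∣p-x∣<∣p∣ x∈p) ∣p∣≤1+d)
... | no  p-empty   = y , ≤-trans (∣p─q∣≤∣p∣ p ⁅ y ⁆) (subst (_≤ _) (sym ∣p∣≡0) z≤n)
  where
  ∣p∣≡0 : ∣ p ∣ ≡ 0
  ∣p∣≡0 = trans (cong ∣_∣ (Empty-unique p-empty)) (∣⊥∣≡0 m)

foldr-⊔-upper : ∀ {A : Set} (f : A → ℕ) {a xs} → a ∈ˡ xs → f a ≤ foldr _⊔_ 0 (map f xs)
foldr-⊔-upper f (here refl)           = m≤m⊔n _ _
foldr-⊔-upper f {xs = b ∷ _} (there a∈xs) = ≤-trans (foldr-⊔-upper f a∈xs) (m≤n⊔m (f b) _)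

N⟨_⟩_ : (G : Graph) → V G → VSet G
N⟨ G ⟩ v = tabulate (adj G v)

module _ {G : Graph} where

  private
    variable
      u v w : V G
      A S : VSet G

  adj⇒∈N : adj G v x ≡ true → x ∈ N⟨ G ⟩ v
  adj⇒∈N {v} {x} vx = lookup⇒[]= x _ (trans (lookup∘tabulate (adj G v) x) vx)

  ∈N⇒adj : x ∈ N⟨ G ⟩ v → adj G v x ≡ true
  ∈N⇒adj {x} {v} x∈N = trans (sym (lookup∘tabulate (adj G v) x)) ([]=⇒lookup x∈N)

  ∣N∣≤Δ : (v : V G) → ∣ N⟨ G ⟩ v ∣ ≤ Δ G
  ∣N∣≤Δ v = foldr-⊔-upper (deg G) (∈-allFin v)

  Force-∪N : v ∈ A → N⟨ G ⟩ v ⊆ A ∪ ⁅ w ⁆ → w ∉ A → w ∈ N⟨ G ⟩ v → Force G A (A ∪ N⟨ G ⟩ v)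
  Force-∪N {v} {A} {w} v∈A N⊆A∪w w∉A w∈N =
    v , w , []=⇒lookup v∈A , ∈N⇒adj w∈N , ∉⇒lookup≡false w∉A , onlyOutside , A∪N≡A∪w
    where
    onlyOutside : ∀ x → adj G v x ≡ true → lookup A x ≡ false → x ≡ w
    onlyOutside x vx Ax≡false with x∈p∪q⁻ A ⁅ w ⁆ (N⊆A∪w (adj⇒∈N vx))
    ... | inj₁ x∈A = contradiction (trans (sym ([]=⇒lookup x∈A)) Ax≡false) λ ()
    ... | inj₂ x∈w = x∈⁅y⁆⇒x≡y w x∈w
    A∪N≡A∪w : A ∪ N⟨ G ⟩ v ≡ A [ w ]≔ true
    A∪N≡A∪w = trans (⊆-antisym (∪-least (p⊆p∪q _) N⊆A∪w) (∪-least (p⊆p∪q _) (q⊆p∪q A _ ∘ ⁅⁆⊆ w∈N)))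
                    (sym ([]≔inside≡∪⁅⁆ A w))

  Propagates-∪⊆ : S ⊆ A → Propagates G A (A ∪ S)
  Propagates-∪⊆ {A = A} S⊆A = subst (Propagates G A) (sym (p⊆q⇒q∪p≡q S⊆A)) ε

  Propagates-∪N : v ∈ A → N⟨ G ⟩ v ⊆ A ∪ ⁅ w ⁆ → Propagates G A (A ∪ N⟨ G ⟩ v)
  Propagates-∪N {v} {A} {w} v∈A N⊆A∪w with w ∈? A | w ∈? N⟨ G ⟩ v
  ... | yes w∈A | _       = Propagates-∪⊆ (⊆-∪⁅⁆-absorb (λ _ → w∈A) N⊆A∪w)
  ... | no  _   | no  w∉N = Propagates-∪⊆ (⊆-∪⁅⁆-absorb (λ w∈N → contradiction w∈N w∉N) N⊆A∪w)
  ... | no  w∉A | yes w∈N = Force-∪N v∈A N⊆A∪w w∉A w∈N ◅ ε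

  ∈N[]⁺ : u ∈ S → adj G u x ≡ true ⊎ u ≡ x → x ∈ N[ G ] S
  ∈N[]⁺ {u} {S} {x} u∈S ux = lookup⇒[]= x (N[ G ] S)
    (trans (lookup∘tabulate _ x) (Equivalence.to T-≡ (any⁺ _ (Any.map (λ { refl → Tu }) (∈-allFin u)))))
    where
    Tu : T (lookup S u ∧ (adj G u x ∨ ⌊ u ≟ x ⌋))
    Tu = Equivalence.from T-∧ (Equivalence.from T-≡ ([]=⇒lookup u∈S) ,
           Equivalence.from T-∨ (Sum.map (Equivalence.from T-≡) fromWitness ux))

  ∈N[]⁻ : x ∈ N[ G ] S → ∃[ u ] u ∈ S × (adj G u x ≡ true ⊎ u ≡ x)
  ∈N[]⁻ {x} {S} x∈N[S] with Any.satisfied (any⁻ _ (allFin _)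
      (Equivalence.from T-≡ (trans (sym (lookup∘tabulate _ x)) ([]=⇒lookup x∈N[S]))))
  ... | u , Tu with Equivalence.to T-∧ Tu
  ...   | TSu , Tux = u , lookup⇒[]= u S (Equivalence.to T-≡ TSu) ,
                      Sum.map (Equivalence.to T-≡) toWitness (Equivalence.to T-∨ Tux)

  S⊆N[S] : S ⊆ N[ G ] S
  S⊆N[S] x∈S = ∈N[]⁺ x∈S (inj₂ refl)

  N⊆N[S] : v ∈ S → N⟨ G ⟩ v ⊆ N[ G ] S
  N⊆N[S] v∈S x∈N = ∈N[]⁺ v∈S (inj₁ (∈N⇒adj x∈N))

  Propagates-∪⋃N : (L : List (V G)) → (∀ {v} → v ∈ˡ L → v ∈ A × ∃[ w ] N⟨ G ⟩ v ⊆ A ∪ ⁅ w ⁆) →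
                   Propagates G A (A ∪ ⋃ (map (N⟨ G ⟩_) L))
  Propagates-∪⋃N {A} [] _ = subst (Propagates G A) (sym (∪-identityʳ A)) ε
  Propagates-∪⋃N {A} (v ∷ L) hyp with hyp (here refl)
  ... | v∈A , w , N⊆A∪w =
    subst (Propagates G A) (∪-assoc A (N⟨ G ⟩ v) _)
      (Propagates-∪N v∈A N⊆A∪w ◅◅ Propagates-∪⋃N L (grow ∘ hyp ∘ there))
    where
    grow : ∀ {u} → u ∈ A × ∃[ w ] N⟨ G ⟩ u ⊆ A ∪ ⁅ w ⁆ →
           u ∈ A ∪ N⟨ G ⟩ v × ∃[ w ] N⟨ G ⟩ u ⊆ (A ∪ N⟨ G ⟩ v) ∪ ⁅ w ⁆
    grow (u∈A , w , N⊆A∪w) = p⊆p∪q _ u∈A , w , ∪-monoˡ-⊆ (p⊆p∪q _) ∘ N⊆A∪w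

  private module ZeroForcingSuperset {d : ℕ} (Δ≡1+d : Δ G ≡ suc d) (S : VSet G) where

    private
      trim : (v : V G) → ∃[ w ] ∣ N⟨ G ⟩ v - w ∣ ≤ d
      trim v = ∣p∣≤1+d⇒∃∣p-x∣≤d (N⟨ G ⟩ v) v (subst (∣ N⟨ G ⟩ v ∣ ≤_) Δ≡1+d (∣N∣≤Δ v))

      D : V G → VSet G
      D v = N⟨ G ⟩ v - proj₁ (trim v)

      B : VSet G
      B = S ∪ ⋃ (map D (elements S))

      ∣B∣≤∣S∣*Δ : ∣ B ∣ ≤ ∣ S ∣ * suc d
      ∣B∣≤∣S∣*Δ = begin
        ∣ B ∣                                   ≤⟨ ∣p∪q∣≤∣p∣+∣q∣ S _ ⟩
        ∣ S ∣ + ∣ ⋃ (map D (elements S)) ∣      ≤⟨ +-monoʳ-≤ ∣ S ∣ (∣⋃-map∣≤ D (proj₂ ∘ trim) (elements S)) ⟩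
        ∣ S ∣ + length (elements S) * d         ≡⟨ cong (λ k → ∣ S ∣ + k * d) (length-elements S) ⟩
        ∣ S ∣ + ∣ S ∣ * d                       ≡⟨ sym (*-suc ∣ S ∣ d) ⟩
        ∣ S ∣ * suc d                           ∎
        where open ≤-Reasoning

      B-propagates : Propagates G B (B ∪ ⋃ (map (N⟨ G ⟩_) (elements S)))
      B-propagates = Propagates-∪⋃N (elements S) λ v∈L →
        p⊆p∪q _ (∈-elements⁻ S v∈L) , proj₁ (trim _) ,
        ∪-monoˡ-⊆ (q⊆p∪q S _ ∘ ⊆-⋃-map D v∈L) ∘ p⊆p-x∪⁅x⁆ _ _

      B∪⋃N≡N[S] : B ∪ ⋃ (map (N⟨ G ⟩_) (elements S)) ≡ N[ G ] S
      B∪⋃N≡N[S] = ⊆-antisym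
        (∪-least (∪-least S⊆N[S] (⋃-map-least D λ {v} v∈L → N⊆N[S] (∈-elements⁻ S v∈L) ∘ p─q⊆p (N⟨ G ⟩ v) _))
                 (⋃-map-least (N⟨ G ⟩_) λ v∈L → N⊆N[S] (∈-elements⁻ S v∈L)))
        λ x∈N[S] → case ∈N[]⁻ x∈N[S] of λ where
          (u , u∈S , inj₁ ux)   → q⊆p∪q B _ (⊆-⋃-map (N⟨ G ⟩_) (∈-elements⁺ u∈S) (adj⇒∈N ux))
          (u , u∈S , inj₂ refl) → p⊆p∪q _ (p⊆p∪q _ u∈S)

    zeroForcingSuperset : IsPowerDominatingSet G S →
      ∃[ B ] S ⊆ B × IsZeroForcingSet G B × ∣ B ∣ ≤ ∣ S ∣ * suc d
    zeroForcingSuperset S-pds =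
      B , p⊆p∪q _ , subst (Propagates G B) B∪⋃N≡N[S] B-propagates ◅◅ S-pds , ∣B∣≤∣S∣*Δ

  IsPowerDominatingSet⇒∃ZeroForcingSuperset : 1 ≤ Δ G → IsPowerDominatingSet G S →
    ∃[ B ] S ⊆ B × IsZeroForcingSet G B × ∣ B ∣ ≤ ∣ S ∣ * Δ G
  IsPowerDominatingSet⇒∃ZeroForcingSuperset {S} 1≤Δ S-pds with Δ G in Δ≡
  ... | suc d = ZeroForcingSuperset.zeroForcingSuperset Δ≡ S S-pds

  N[⊤]≡⊤ : N[ G ] ⊤ ≡ ⊤
  N[⊤]≡⊤ = ⊆-antisym ⊆⊤ S⊆N[S]

⌈/⌉≤ : ∀ {z g k} → 1 ≤ k → z ≤ g * k → ⌈ z / k ⌉ ≤ g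
⌈/⌉≤ {z} {g} {suc d} _ z≤g*k = begin
  (z + d) / suc d                ≤⟨ /-monoˡ-≤ (suc d) (+-monoˡ-≤ d z≤g*k) ⟩
  (g * suc d + d) / suc d        ≡⟨ +-distrib-/-∣ˡ d (n∣m*n g) ⟩
  g * suc d / suc d + d / suc d  ≡⟨ cong₂ _+_ (m*n/n≡m g (suc d)) (m<n⇒m/n≡0 (n<1+n d)) ⟩
  g + 0                          ≡⟨ +-identityʳ g ⟩
  g                              ∎
  where open ≤-Reasoning

module _ (G : Graph) where

  IsZ-⊤ : IsZ G ⊤ (n G)
  IsZ-⊤ = (⊤ , ⊆-refl , ε , ∣⊤∣≡n (n G)) ,
          λ B ⊤⊆B _ → subst (_≤ ∣ B ∣) (∣⊤∣≡n (n G)) (p⊆q⇒∣p∣≤∣q∣ ⊤⊆B)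

  IsγP-⊤ : IsγP G ⊤ (n G)
  IsγP-⊤ = (⊤ , ⊆-refl , subst (λ A → Propagates G A ⊤) (sym (N[⊤]≡⊤ {G = G})) ε , ∣⊤∣≡n (n G)) ,
           λ S ⊤⊆S _ → subst (_≤ ∣ S ∣) (∣⊤∣≡n (n G)) (p⊆q⇒∣p∣≤∣q∣ ⊤⊆S)

K₂ : Graph
K₂ = record { n = 2 ; adj = λ u v → not ⌊ u ≟ v ⌋ ; sym = sym-≢ ; irrefl = irrefl-≢ }
  where
  sym-≢ : (u v : Fin 2) → not ⌊ u ≟ v ⌋ ≡ not ⌊ v ≟ u ⌋
  sym-≢ fz      fz      = refl
  sym-≢ fz      (fs fz) = refl
  sym-≢ (fs fz) fz      = refl
  sym-≢ (fs fz) (fs fz) = refl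
  irrefl-≢ : (v : Fin 2) → not ⌊ v ≟ v ⌋ ≡ false
  irrefl-≢ fz      = refl
  irrefl-≢ (fs fz) = refl

⌈Z/Δ⌉≤γP : (G : Graph) → 1 ≤ Δ G → (X : VSet G) → (z g : ℕ) →
            IsZ G X z → IsγP G X g → ⌈ z / Δ G ⌉ ≤ g
⌈Z/Δ⌉≤γP G 1≤Δ X z g (_ , Z-minimal) ((S , X⊆S , S-pds , ∣S∣≡g) , _)
  with B , S⊆B , B-zfs , ∣B∣≤∣S∣*Δ ← IsPowerDominatingSet⇒∃ZeroForcingSuperset {G = G} 1≤Δ S-pds =
  ⌈/⌉≤ 1≤Δ (begin
    z            ≤⟨ Z-minimal B (S⊆B ∘ X⊆S) B-zfs ⟩
    ∣ B ∣        ≤⟨ ∣B∣≤∣S∣*Δ ⟩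
    ∣ S ∣ * Δ G  ≡⟨ cong (_* Δ G) ∣S∣≡g ⟩
    g * Δ G      ∎)
  where open ≤-Reasoning

theorem3p16 : ((G : Graph) → 1 ≤ Δ G → (X : VSet G) → (z g : ℕ) →
    IsZ G X z → IsγP G X g → ⌈ z / Δ G ⌉ ≤ g)
    ×
    (Σ Graph λ G → Σ (VSet G) λ X → Σ ℕ λ z → Σ ℕ λ g →
    1 ≤ Δ G × IsZ G X z × IsγP G X g × ⌈ z / Δ G ⌉ ≡ g)
theorem3p16 = ⌈Z/Δ⌉≤γP , (K₂ , ⊤ , 2 , 2 , s≤s z≤n , IsZ-⊤ K₂ , IsγP-⊤ K₂ , refl)
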